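{- Let $p,p',q,q'$ be integers with $p\ge p'\ge0$ and $q\ge q'\ge0$. Then for every polynomial $P(z)\in\mathbb Q[z]$ there exists a polynomial $R(z)\in\mathbb Q[z]$ such that $\mathcal D_{p,q}(P(z))=\mathcal D_{p',q'}(R(z))$.
   Context: For an integer $r\ge0$, $D_rf(z)=\frac1{r!}\frac{d^r}{dz^r}f(z)$. For integers $p,q\ge0$ and $P\in\mathbb C[z]$, $\mathcal D_{p,q}(P(z))=z^q(1-z)^pD_{p+q}\big(z^p(1-z)^qP(z)\big)$. -}

module Defs where

open import Data.Nat.Base using (ℕ; zero; suc; _!)
open import Data.Nat.Properties using (_!≢0)
open import Data.Integer.Base using (+_)
open import Data.Rational.Base using (ℚ; 0ℚ; 1ℚ; _/_; -_) renaming (_+_ to _+ℚ_; _*_ to _*ℚ_)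
open import Data.List.Base using (List; []; _∷_; map)
open import Relation.Binary.PropositionalEquality using (_≡_)

-- Polynomials in ℚ[z], represented by coefficient lists, lowest degree first:
-- a₀ ∷ a₁ ∷ … ∷ aₙ ∷ []  represents  a₀ + a₁ z + … + aₙ zⁿ.
-- Different lists may represent the same polynomial (trailing zeros), so
-- equality of polynomials is coefficientwise equality, _≈ₚ_ below.
Poly : Set
Poly = List ℚ

coeff : Poly → ℕ → ℚ
coeff []       _       = 0ℚ
coeff (a ∷ _)  zero    = a
coeff (_ ∷ f)  (suc n) = coeff f n

infix 4 _≈ₚ_
_≈ₚ_ : Poly → Poly → Set
f ≈ₚ g = ∀ n → coeff f n ≡ coeff g n

infixl 6 _+ₚ_
_+ₚ_ : Poly → Poly → Poly
[]      +ₚ g       = g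
f       +ₚ []      = f
(a ∷ f) +ₚ (b ∷ g) = (a +ℚ b) ∷ (f +ₚ g)

_·ₚ_ : ℚ → Poly → Poly
c ·ₚ f = map (c *ℚ_) f

infixl 7 _*ₚ_
_*ₚ_ : Poly → Poly → Poly
[]      *ₚ g = []
(a ∷ f) *ₚ g = (a ·ₚ g) +ₚ (0ℚ ∷ (f *ₚ g))

_^ₚ_ : Poly → ℕ → Poly
f ^ₚ zero  = 1ℚ ∷ []
f ^ₚ suc n = f *ₚ (f ^ₚ n)

zₚ : Poly
zₚ = 0ℚ ∷ 1ℚ ∷ []

oneMinusZ : Poly
oneMinusZ = 1ℚ ∷ (- 1ℚ) ∷ []

deriv : Poly → Poly
deriv []      = []
deriv (_ ∷ f) = go 1 f
  where
  go : ℕ → Poly → Poly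
  go k []      = []
  go k (a ∷ g) = ((+ k / 1) *ℚ a) ∷ go (suc k) g

derivN : ℕ → Poly → Poly
derivN zero    f = f
derivN (suc r) f = deriv (derivN r f)

Dr : ℕ → Poly → Poly
Dr r f = ((+ 1 / (r !)) {{r !≢0}}) ·ₚ derivN r f

open import Data.Nat.Base using (_+_)

𝒟 : ℕ → ℕ → Poly → Poly
𝒟 p q P = (zₚ ^ₚ q) *ₚ (oneMinusZ ^ₚ p) *ₚ Dr (p + q) ((zₚ ^ₚ p) *ₚ (oneMinusZ ^ₚ q) *ₚ P)

{-# OPTIONS --safe #-}
module Submission where

open import Defs
open import Data.Nat.Base using (ℕ; _≤_)
open import Data.Product using (∃)

open import Data.Nat.Base using (zero; suc; _+_; _∸_; _!; z≤n; s≤s)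
import Data.Nat.Properties as ℕ
open import Data.Nat.Properties using (_!≢0)
open import Data.Integer.Base using (+_)
open import Data.Product using (_×_; _,_)
open import Data.Sum using (inj₁; inj₂)
open import Data.List.Base using ([]; _∷_; length)
open import Data.Rational.Base
  using (ℚ; 0ℚ; 1ℚ; -_; _/_; _÷_; 1/_; Positive; NonZero; ≢-nonZero)
  renaming (_+_ to _+q_; _*_ to _*q_)
import Data.Rational.Properties as ℚ
open import Data.Rational.Solver using (module +-*-Solver)
open +-*-Solver using (solve; _:+_; _:*_; :-_; _:=_)
open import Algebra.Apartness.Properties.HeytingCommutativeRing ℚ.heytingCommutativeRing
  using (x#0y#0→xy#0)
open import Algebra.Bundles using (CommutativeMonoid)
import Algebra.Properties.CommutativeSemigroup as CommutativeSemigroupProperties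
open import Function using (_∘_)
open import Level using (0ℓ)
open import Relation.Binary.Bundles using (Setoid)
open import Relation.Binary.Structures using (IsEquivalence)
import Relation.Binary.Reasoning.Setoid
open import Relation.Binary.PropositionalEquality

-- By definition 𝒟 p q P = z^q (1-z)^p · T_{p,q}(P) with T_{p,q}(P) = D_{p+q}(z^p (1-z)^q P).
-- T_{p,q} is linear, and it sends z^m to a polynomial of degree exactly m: z^p (1-z)^q z^m
-- has degree p+q+m, and D_r multiplies the coefficient of z^(r+k) by a nonzero constant
-- and moves it to z^k.  Triangularity makes T_{p,q} onto ℚ[z], so
-- z^(q-q′) (1-z)^(p-p′) T_{p,q}(P) = T_{p′,q′}(R) for some R; multiplying by
-- z^q′ (1-z)^p′ gives 𝒟 p q P = 𝒟 p′ q′ R.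

-- Arithmetic of ℚ[z]

-- Coefficientwise equality as a record: unlike _≈ₚ_, which unfolds to a Π-type,
-- it lets Agda infer the polynomials it relates.
infix 4 _≋_
record _≋_ (f g : Poly) : Set where
  constructor coeffwise
  field coeff-≡ : f ≈ₚ g
open _≋_

≋-isEquivalence : IsEquivalence _≋_
≋-isEquivalence = record
  { refl  = coeffwise λ _ → refl
  ; sym   = λ f≋g → coeffwise λ n → sym (coeff-≡ f≋g n)
  ; trans = λ f≋g g≋h → coeffwise λ n → trans (coeff-≡ f≋g n) (coeff-≡ g≋h n)
  }

≋-setoid : Setoid 0ℓ 0ℓ
≋-setoid = record { isEquivalence = ≋-isEquivalence }

open IsEquivalence ≋-isEquivalence
  using () renaming (refl to ≋-refl; reflexive to ≋-reflexive; sym to ≋-sym; trans to ≋-trans)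
module ≋-Reasoning = Relation.Binary.Reasoning.Setoid ≋-setoid

open import Algebra.Definitions _≋_
open import Algebra.Structures _≋_ using (IsCommutativeMonoid)
open import Algebra.Structures.Biased _≋_ using (isCommutativeMonoidˡ)
coeff-+ₚ : ∀ f g n → coeff (f +ₚ g) n ≡ coeff f n +q coeff g n
coeff-+ₚ []      g       n       = sym (ℚ.+-identityˡ _)
coeff-+ₚ (a ∷ f) []      n       = sym (ℚ.+-identityʳ _)
coeff-+ₚ (a ∷ f) (b ∷ g) zero    = refl
coeff-+ₚ (a ∷ f) (b ∷ g) (suc n) = coeff-+ₚ f g n

coeff-·ₚ : ∀ c f n → coeff (c ·ₚ f) n ≡ c *q coeff f n
coeff-·ₚ c []      n       = sym (ℚ.*-zeroʳ c)
coeff-·ₚ c (a ∷ f) zero    = refl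
coeff-·ₚ c (a ∷ f) (suc n) = coeff-·ₚ c f n

∷-cong : ∀ {a b f g} → a ≡ b → f ≋ g → a ∷ f ≋ b ∷ g
∷-cong a≡b f≋g = coeffwise λ where
  zero    → a≡b
  (suc n) → coeff-≡ f≋g n

0∷[]≋[] : 0ℚ ∷ [] ≋ []
0∷[]≋[] = coeffwise λ where
  zero    → refl
  (suc n) → refl

+ₚ-cong : Congruent₂ _+ₚ_
+ₚ-cong {f} {f′} {g} {g′} f≋f′ g≋g′ = coeffwise λ n → begin
  coeff (f +ₚ g) n          ≡⟨ coeff-+ₚ f g n ⟩
  coeff f n +q coeff g n    ≡⟨ cong₂ _+q_ (coeff-≡ f≋f′ n) (coeff-≡ g≋g′ n) ⟩
  coeff f′ n +q coeff g′ n  ≡⟨ coeff-+ₚ f′ g′ n ⟨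
  coeff (f′ +ₚ g′) n        ∎
  where open ≡-Reasoning

+ₚ-congˡ : ∀ f {g h} → g ≋ h → f +ₚ g ≋ f +ₚ h
+ₚ-congˡ f = +ₚ-cong (≋-refl {f})

+ₚ-assoc : Associative _+ₚ_
+ₚ-assoc f g h = coeffwise λ n → begin
  coeff ((f +ₚ g) +ₚ h) n                    ≡⟨ coeff-+ₚ (f +ₚ g) h n ⟩
  coeff (f +ₚ g) n +q coeff h n              ≡⟨ cong (_+q coeff h n) (coeff-+ₚ f g n) ⟩
  (coeff f n +q coeff g n) +q coeff h n      ≡⟨ ℚ.+-assoc (coeff f n) (coeff g n) (coeff h n) ⟩
  coeff f n +q (coeff g n +q coeff h n)      ≡⟨ cong (coeff f n +q_) (coeff-+ₚ g h n) ⟨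
  coeff f n +q coeff (g +ₚ h) n              ≡⟨ coeff-+ₚ f (g +ₚ h) n ⟨
  coeff (f +ₚ (g +ₚ h)) n                    ∎
  where open ≡-Reasoning

+ₚ-comm : Commutative _+ₚ_
+ₚ-comm f g = coeffwise λ n → begin
  coeff (f +ₚ g) n        ≡⟨ coeff-+ₚ f g n ⟩
  coeff f n +q coeff g n  ≡⟨ ℚ.+-comm (coeff f n) (coeff g n) ⟩
  coeff g n +q coeff f n  ≡⟨ coeff-+ₚ g f n ⟨
  coeff (g +ₚ f) n        ∎
  where open ≡-Reasoning

+ₚ-identityʳ : RightIdentity [] _+ₚ_
+ₚ-identityʳ []      = ≋-refl
+ₚ-identityʳ (a ∷ f) = ≋-refl

+ₚ-isCommutativeMonoid : IsCommutativeMonoid _+ₚ_ []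
+ₚ-isCommutativeMonoid = isCommutativeMonoidˡ record
  { isSemigroup = record
    { isMagma = record { isEquivalence = ≋-isEquivalence ; ∙-cong = +ₚ-cong }
    ; assoc   = +ₚ-assoc
    }
  ; identityˡ = λ _ → ≋-refl
  ; comm      = +ₚ-comm
  }

+ₚ-commutativeMonoid : CommutativeMonoid 0ℓ 0ℓ
+ₚ-commutativeMonoid = record { isCommutativeMonoid = +ₚ-isCommutativeMonoid }

module +ₚ = CommutativeSemigroupProperties (CommutativeMonoid.commutativeSemigroup +ₚ-commutativeMonoid)

·ₚ-congˡ : ∀ c {f g} → f ≋ g → c ·ₚ f ≋ c ·ₚ g
·ₚ-congˡ c {f} {g} f≋g = coeffwise λ n → begin
  coeff (c ·ₚ f) n   ≡⟨ coeff-·ₚ c f n ⟩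
  c *q coeff f n     ≡⟨ cong (c *q_) (coeff-≡ f≋g n) ⟩
  c *q coeff g n     ≡⟨ coeff-·ₚ c g n ⟨
  coeff (c ·ₚ g) n   ∎
  where open ≡-Reasoning

·ₚ-distribˡ-+ₚ : ∀ c f g → c ·ₚ (f +ₚ g) ≋ c ·ₚ f +ₚ c ·ₚ g
·ₚ-distribˡ-+ₚ c f g = coeffwise λ n → begin
  coeff (c ·ₚ (f +ₚ g)) n                    ≡⟨ coeff-·ₚ c (f +ₚ g) n ⟩
  c *q coeff (f +ₚ g) n                      ≡⟨ cong (c *q_) (coeff-+ₚ f g n) ⟩
  c *q (coeff f n +q coeff g n)              ≡⟨ ℚ.*-distribˡ-+ c (coeff f n) (coeff g n) ⟩
  c *q coeff f n +q c *q coeff g n           ≡⟨ cong₂ _+q_ (coeff-·ₚ c f n) (coeff-·ₚ c g n) ⟨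
  coeff (c ·ₚ f) n +q coeff (c ·ₚ g) n       ≡⟨ coeff-+ₚ (c ·ₚ f) (c ·ₚ g) n ⟨
  coeff (c ·ₚ f +ₚ c ·ₚ g) n                 ∎
  where open ≡-Reasoning

·ₚ-assoc : ∀ a b f → (a *q b) ·ₚ f ≋ a ·ₚ (b ·ₚ f)
·ₚ-assoc a b f = coeffwise λ n → begin
  coeff ((a *q b) ·ₚ f) n    ≡⟨ coeff-·ₚ (a *q b) f n ⟩
  (a *q b) *q coeff f n      ≡⟨ ℚ.*-assoc a b (coeff f n) ⟩
  a *q (b *q coeff f n)      ≡⟨ cong (a *q_) (coeff-·ₚ b f n) ⟨
  a *q coeff (b ·ₚ f) n      ≡⟨ coeff-·ₚ a (b ·ₚ f) n ⟨
  coeff (a ·ₚ (b ·ₚ f)) n    ∎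
  where open ≡-Reasoning

·ₚ-zeroˡ : ∀ f → 0ℚ ·ₚ f ≋ []
·ₚ-zeroˡ f = coeffwise λ n → trans (coeff-·ₚ 0ℚ f n) (ℚ.*-zeroˡ (coeff f n))

·ₚ-identityˡ : ∀ f → 1ℚ ·ₚ f ≋ f
·ₚ-identityˡ f = coeffwise λ n → trans (coeff-·ₚ 1ℚ f n) (ℚ.*-identityˡ (coeff f n))

+ₚ-neg-·ₚ-cancel : ∀ f a g → (f +ₚ (- a) ·ₚ g) +ₚ a ·ₚ g ≋ f
+ₚ-neg-·ₚ-cancel f a g = coeffwise λ n → begin
  coeff ((f +ₚ (- a) ·ₚ g) +ₚ a ·ₚ g) n
    ≡⟨ coeff-+ₚ (f +ₚ (- a) ·ₚ g) (a ·ₚ g) n ⟩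
  coeff (f +ₚ (- a) ·ₚ g) n +q coeff (a ·ₚ g) n
    ≡⟨ cong₂ _+q_ (trans (coeff-+ₚ f ((- a) ·ₚ g) n) (cong (coeff f n +q_) (coeff-·ₚ (- a) g n)))
                  (coeff-·ₚ a g n) ⟩
  (coeff f n +q (- a) *q coeff g n) +q a *q coeff g n
    ≡⟨ solve 3 (λ x a y → (x :+ (:- a) :* y) :+ a :* y := x) refl (coeff f n) a (coeff g n) ⟩
  coeff f n
    ∎
  where open ≡-Reasoning

0∷-+ₚ : ∀ f g → 0ℚ ∷ (f +ₚ g) ≋ (0ℚ ∷ f) +ₚ (0ℚ ∷ g)
0∷-+ₚ f g = ∷-cong (sym (ℚ.+-identityʳ 0ℚ)) ≋-refl

0∷-·ₚ : ∀ c f → 0ℚ ∷ (c ·ₚ f) ≋ c ·ₚ (0ℚ ∷ f)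
0∷-·ₚ c f = ∷-cong (sym (ℚ.*-zeroʳ c)) ≋-refl

*ₚ-zeroʳ : RightZero [] _*ₚ_
*ₚ-zeroʳ []      = ≋-refl
*ₚ-zeroʳ (a ∷ f) = ≋-trans (∷-cong refl (*ₚ-zeroʳ f)) 0∷[]≋[]

*ₚ-congˡ : ∀ f {g h} → g ≋ h → f *ₚ g ≋ f *ₚ h
*ₚ-congˡ []      g≋h = ≋-refl
*ₚ-congˡ (a ∷ f) g≋h = +ₚ-cong (·ₚ-congˡ a g≋h) (∷-cong refl (*ₚ-congˡ f g≋h))

*ₚ-∷ʳ : ∀ f b g → f *ₚ (b ∷ g) ≋ b ·ₚ f +ₚ (0ℚ ∷ f *ₚ g)
*ₚ-∷ʳ []      b g = ≋-sym 0∷[]≋[]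
*ₚ-∷ʳ (a ∷ f) b g = ∷-cong (cong (_+q 0ℚ) (ℚ.*-comm a b)) (begin
  a ·ₚ g +ₚ f *ₚ (b ∷ g)               ≈⟨ +ₚ-congˡ (a ·ₚ g) (*ₚ-∷ʳ f b g) ⟩
  a ·ₚ g +ₚ (b ·ₚ f +ₚ (0ℚ ∷ f *ₚ g))  ≈⟨ +ₚ.x∙yz≈y∙xz (a ·ₚ g) (b ·ₚ f) (0ℚ ∷ f *ₚ g) ⟩
  b ·ₚ f +ₚ (a ·ₚ g +ₚ (0ℚ ∷ f *ₚ g))  ∎)
  where open ≋-Reasoning

*ₚ-comm : Commutative _*ₚ_
*ₚ-comm []      g = ≋-sym (*ₚ-zeroʳ g)
*ₚ-comm (a ∷ f) g = begin
  a ·ₚ g +ₚ (0ℚ ∷ f *ₚ g)  ≈⟨ +ₚ-congˡ (a ·ₚ g) (∷-cong refl (*ₚ-comm f g)) ⟩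
  a ·ₚ g +ₚ (0ℚ ∷ g *ₚ f)  ≈⟨ *ₚ-∷ʳ g a f ⟨
  g *ₚ (a ∷ f)             ∎
  where open ≋-Reasoning

*ₚ-cong : Congruent₂ _*ₚ_
*ₚ-cong {f} {f′} {g} {g′} f≋f′ g≋g′ = begin
  f *ₚ g    ≈⟨ *ₚ-congˡ f g≋g′ ⟩
  f *ₚ g′   ≈⟨ *ₚ-comm f g′ ⟩
  g′ *ₚ f   ≈⟨ *ₚ-congˡ g′ f≋f′ ⟩
  g′ *ₚ f′  ≈⟨ *ₚ-comm g′ f′ ⟩
  f′ *ₚ g′  ∎
  where open ≋-Reasoning

*ₚ-distribˡ-+ₚ : _*ₚ_ DistributesOverˡ _+ₚ_
*ₚ-distribˡ-+ₚ []      g h = ≋-refl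
*ₚ-distribˡ-+ₚ (a ∷ f) g h = begin
  a ·ₚ (g +ₚ h) +ₚ (0ℚ ∷ f *ₚ (g +ₚ h))
    ≈⟨ +ₚ-cong (·ₚ-distribˡ-+ₚ a g h) (≋-trans (∷-cong refl (*ₚ-distribˡ-+ₚ f g h)) (0∷-+ₚ (f *ₚ g) (f *ₚ h))) ⟩
  (a ·ₚ g +ₚ a ·ₚ h) +ₚ ((0ℚ ∷ f *ₚ g) +ₚ (0ℚ ∷ f *ₚ h))
    ≈⟨ +ₚ.interchange (a ·ₚ g) (a ·ₚ h) (0ℚ ∷ f *ₚ g) (0ℚ ∷ f *ₚ h) ⟩
  (a ·ₚ g +ₚ (0ℚ ∷ f *ₚ g)) +ₚ (a ·ₚ h +ₚ (0ℚ ∷ f *ₚ h))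
    ∎
  where open ≋-Reasoning

*ₚ-distribʳ-+ₚ : _*ₚ_ DistributesOverʳ _+ₚ_
*ₚ-distribʳ-+ₚ f g h = begin
  (g +ₚ h) *ₚ f        ≈⟨ *ₚ-comm (g +ₚ h) f ⟩
  f *ₚ (g +ₚ h)        ≈⟨ *ₚ-distribˡ-+ₚ f g h ⟩
  f *ₚ g +ₚ f *ₚ h     ≈⟨ +ₚ-cong (*ₚ-comm f g) (*ₚ-comm f h) ⟩
  g *ₚ f +ₚ h *ₚ f     ∎
  where open ≋-Reasoning

*ₚ-·ₚˡ : ∀ c f g → (c ·ₚ f) *ₚ g ≋ c ·ₚ (f *ₚ g)
*ₚ-·ₚˡ c []      g = ≋-refl
*ₚ-·ₚˡ c (a ∷ f) g = begin
  (c *q a) ·ₚ g +ₚ (0ℚ ∷ (c ·ₚ f) *ₚ g)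
    ≈⟨ +ₚ-cong (·ₚ-assoc c a g) (≋-trans (∷-cong refl (*ₚ-·ₚˡ c f g)) (0∷-·ₚ c (f *ₚ g))) ⟩
  c ·ₚ (a ·ₚ g) +ₚ c ·ₚ (0ℚ ∷ f *ₚ g)
    ≈⟨ ·ₚ-distribˡ-+ₚ c (a ·ₚ g) (0ℚ ∷ f *ₚ g) ⟨
  c ·ₚ (a ·ₚ g +ₚ (0ℚ ∷ f *ₚ g))
    ∎
  where open ≋-Reasoning

*ₚ-·ₚʳ : ∀ c f g → f *ₚ (c ·ₚ g) ≋ c ·ₚ (f *ₚ g)
*ₚ-·ₚʳ c f g = begin
  f *ₚ (c ·ₚ g)   ≈⟨ *ₚ-comm f (c ·ₚ g) ⟩
  (c ·ₚ g) *ₚ f   ≈⟨ *ₚ-·ₚˡ c g f ⟩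
  c ·ₚ (g *ₚ f)   ≈⟨ ·ₚ-congˡ c (*ₚ-comm g f) ⟩
  c ·ₚ (f *ₚ g)   ∎
  where open ≋-Reasoning

0∷-*ₚ : ∀ f g → (0ℚ ∷ f) *ₚ g ≋ 0ℚ ∷ f *ₚ g
0∷-*ₚ f g = +ₚ-cong (·ₚ-zeroˡ g) ≋-refl

*ₚ-assoc : Associative _*ₚ_
*ₚ-assoc []      g h = ≋-refl
*ₚ-assoc (a ∷ f) g h = begin
  (a ·ₚ g +ₚ (0ℚ ∷ f *ₚ g)) *ₚ h        ≈⟨ *ₚ-distribʳ-+ₚ h (a ·ₚ g) (0ℚ ∷ f *ₚ g) ⟩
  (a ·ₚ g) *ₚ h +ₚ (0ℚ ∷ f *ₚ g) *ₚ h   ≈⟨ +ₚ-cong (*ₚ-·ₚˡ a g h) (0∷-*ₚ (f *ₚ g) h) ⟩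
  a ·ₚ (g *ₚ h) +ₚ (0ℚ ∷ f *ₚ g *ₚ h)   ≈⟨ +ₚ-congˡ (a ·ₚ (g *ₚ h)) (∷-cong refl (*ₚ-assoc f g h)) ⟩
  a ·ₚ (g *ₚ h) +ₚ (0ℚ ∷ f *ₚ (g *ₚ h)) ∎
  where open ≋-Reasoning

*ₚ-identityˡ : LeftIdentity (1ℚ ∷ []) _*ₚ_
*ₚ-identityˡ f = begin
  1ℚ ·ₚ f +ₚ (0ℚ ∷ [])  ≈⟨ +ₚ-cong (·ₚ-identityˡ f) 0∷[]≋[] ⟩
  f +ₚ []               ≈⟨ +ₚ-identityʳ f ⟩
  f                     ∎
  where open ≋-Reasoning

*ₚ-isCommutativeMonoid : IsCommutativeMonoid _*ₚ_ (1ℚ ∷ [])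
*ₚ-isCommutativeMonoid = isCommutativeMonoidˡ record
  { isSemigroup = record
    { isMagma = record { isEquivalence = ≋-isEquivalence ; ∙-cong = *ₚ-cong }
    ; assoc   = *ₚ-assoc
    }
  ; identityˡ = *ₚ-identityˡ
  ; comm      = *ₚ-comm
  }

*ₚ-commutativeMonoid : CommutativeMonoid 0ℓ 0ℓ
*ₚ-commutativeMonoid = record { isCommutativeMonoid = *ₚ-isCommutativeMonoid }

module *ₚ = CommutativeSemigroupProperties (CommutativeMonoid.commutativeSemigroup *ₚ-commutativeMonoid)

^ₚ-homo-*ₚ : ∀ f m n → f ^ₚ (m + n) ≋ f ^ₚ m *ₚ f ^ₚ n
^ₚ-homo-*ₚ f zero    n = ≋-sym (*ₚ-identityˡ (f ^ₚ n))
^ₚ-homo-*ₚ f (suc m) n = begin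
  f *ₚ f ^ₚ (m + n)            ≈⟨ *ₚ-congˡ f (^ₚ-homo-*ₚ f m n) ⟩
  f *ₚ (f ^ₚ m *ₚ f ^ₚ n)      ≈⟨ *ₚ-assoc f (f ^ₚ m) (f ^ₚ n) ⟨
  f *ₚ f ^ₚ m *ₚ f ^ₚ n        ∎
  where open ≋-Reasoning

-- Coefficients of derivatives

fromℕ : ℕ → ℚ
fromℕ k = + k / 1

record IndexScaling (go : ℕ → Poly → Poly) : Set where
  field
    go-[] : ∀ k → go k [] ≡ []
    go-∷  : ∀ k a g → go k (a ∷ g) ≡ (fromℕ k *q a) ∷ go (suc k) g

coeff-indexScaling : ∀ {go} → IndexScaling go → ∀ k g n → coeff (go k g) n ≡ fromℕ (k + n) *q coeff g n
coeff-indexScaling sc k []      n       rewrite IndexScaling.go-[] sc k = sym (ℚ.*-zeroʳ (fromℕ (k + n)))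
coeff-indexScaling sc k (a ∷ g) zero    rewrite IndexScaling.go-∷ sc k a g | ℕ.+-identityʳ k = refl
coeff-indexScaling sc k (a ∷ g) (suc n) rewrite IndexScaling.go-∷ sc k a g | ℕ.+-suc k n =
  coeff-indexScaling sc (suc k) g n

-- `deriv` is defined through a local helper that cannot be named here; abstracting
-- the literal 1 makes its equation a higher-order pattern, so unification recovers it.
deriv-∷ : ∀ a → ∃ λ go → IndexScaling go × (∀ f → deriv (a ∷ f) ≡ go 1 f)
deriv-∷ a = go , record { go-[] = λ _ → refl ; go-∷ = λ _ _ _ → refl } , deriv≡go
  where
  go : ℕ → Poly → Poly
  go = _
  deriv≡go : ∀ f → deriv (a ∷ f) ≡ go 1 f
  deriv≡go f with 1
  ... | _ = refl

coeff-deriv : ∀ f n → coeff (deriv f) n ≡ fromℕ (suc n) *q coeff f (suc n)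
coeff-deriv []      n = sym (ℚ.*-zeroʳ (fromℕ (suc n)))
coeff-deriv (a ∷ f) n with deriv-∷ a
... | go , scaling , deriv≡go =
  trans (cong (λ h → coeff h n) (deriv≡go f)) (coeff-indexScaling scaling 1 f n)

risingFactorial : ℕ → ℕ → ℚ
risingFactorial x zero    = 1ℚ
risingFactorial x (suc r) = fromℕ x *q risingFactorial (suc x) r

risingFactorial-pos : ∀ x r → Positive (risingFactorial (suc x) r)
risingFactorial-pos x zero    = _
risingFactorial-pos x (suc r) =
  ℚ.pos*pos⇒pos (fromℕ (suc x)) {{ℚ.normalize-pos (suc x) 1}} _ {{risingFactorial-pos (suc x) r}}

coeff-derivN : ∀ r f k → coeff (derivN r f) k ≡ risingFactorial (suc k) r *q coeff f (r + k)
coeff-derivN zero    f k = sym (ℚ.*-identityˡ (coeff f k))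
coeff-derivN (suc r) f k = begin
  coeff (deriv (derivN r f)) k
    ≡⟨ coeff-deriv (derivN r f) k ⟩
  fromℕ (suc k) *q coeff (derivN r f) (suc k)
    ≡⟨ cong (fromℕ (suc k) *q_) (coeff-derivN r f (suc k)) ⟩
  fromℕ (suc k) *q (risingFactorial (suc (suc k)) r *q coeff f (r + suc k))
    ≡⟨ ℚ.*-assoc (fromℕ (suc k)) _ _ ⟨
  risingFactorial (suc k) (suc r) *q coeff f (r + suc k)
    ≡⟨ cong (λ i → risingFactorial (suc k) (suc r) *q coeff f i) (ℕ.+-suc r k) ⟩
  risingFactorial (suc k) (suc r) *q coeff f (suc r + k)
    ∎
  where open ≡-Reasoning

1/r! : ℕ → ℚ
1/r! r = (+ 1 / (r !)) {{r !≢0}}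

-- Dr-scale r k is the binomial coefficient (r + k choose r).
Dr-scale : ℕ → ℕ → ℚ
Dr-scale r k = 1/r! r *q risingFactorial (suc k) r

Dr-scale≢0 : ∀ r k → Dr-scale r k ≢ 0ℚ
Dr-scale≢0 r k = ≢-sym (ℚ.<⇒≢ (ℚ.positive⁻¹ (Dr-scale r k) {{scale-pos}}))
  where
  scale-pos : Positive (Dr-scale r k)
  scale-pos = ℚ.pos*pos⇒pos (1/r! r) {{ℚ.normalize-pos 1 (r !) {{r !≢0}}}}
                            (risingFactorial (suc k) r) {{risingFactorial-pos k r}}

coeff-Dr : ∀ r f k → coeff (Dr r f) k ≡ Dr-scale r k *q coeff f (r + k)
coeff-Dr r f k = begin
  coeff (Dr r f) k                                              ≡⟨ coeff-·ₚ (1/r! r) (derivN r f) k ⟩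
  1/r! r *q coeff (derivN r f) k                                ≡⟨ cong (1/r! r *q_) (coeff-derivN r f k) ⟩
  1/r! r *q (risingFactorial (suc k) r *q coeff f (r + k))      ≡⟨ ℚ.*-assoc (1/r! r) _ _ ⟨
  Dr-scale r k *q coeff f (r + k)                               ∎
  where open ≡-Reasoning

-- Degrees

DegreeBelow : ℕ → Poly → Set
DegreeBelow m f = ∀ k → m ≤ k → coeff f k ≡ 0ℚ

record HasDegree (d : ℕ) (f : Poly) : Set where
  field
    degreeBelow : DegreeBelow (suc d) f
    leading≢0   : coeff f d ≢ 0ℚ
open HasDegree

degreeBelow-length : ∀ f → DegreeBelow (length f) f
degreeBelow-length []      k       _         = refl
degreeBelow-length (a ∷ f) (suc k) (s≤s f≤k) = degreeBelow-length f k f≤k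

degreeBelow-zero : ∀ f → DegreeBelow 0 f → f ≋ []
degreeBelow-zero f f<0 = coeffwise λ k → f<0 k z≤n

degreeBelow-linear : ∀ a b → DegreeBelow 2 (a ∷ b ∷ [])
degreeBelow-linear a b (suc zero)    (s≤s ())
degreeBelow-linear a b (suc (suc k)) _ = refl

coeff-∷*ₚ : ∀ a f g n → coeff ((a ∷ f) *ₚ g) n ≡ a *q coeff g n +q coeff (0ℚ ∷ f *ₚ g) n
coeff-∷*ₚ a f g n = trans (coeff-+ₚ (a ·ₚ g) (0ℚ ∷ f *ₚ g) n) (cong (_+q _) (coeff-·ₚ a g n))

*ₚ-degreeBelow : ∀ m e f g → DegreeBelow m f → DegreeBelow (suc e) g → DegreeBelow (m + e) (f *ₚ g)
*ₚ-degreeBelow zero    e f       g f<0 _ k _ = coeff-≡ (*ₚ-cong (degreeBelow-zero f f<0) (≋-refl {g})) k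
*ₚ-degreeBelow (suc m) e []      g _   _ k _ = refl
*ₚ-degreeBelow (suc m) e (a ∷ f) g f<m g<e (suc k) (s≤s m+e≤k) = begin
  coeff ((a ∷ f) *ₚ g) (suc k)                   ≡⟨ coeff-∷*ₚ a f g (suc k) ⟩
  a *q coeff g (suc k) +q coeff (f *ₚ g) k       ≡⟨ cong₂ (λ x y → a *q x +q y) g-vanishes fg-vanishes ⟩
  a *q 0ℚ +q 0ℚ                                  ≡⟨ trans (ℚ.+-identityʳ _) (ℚ.*-zeroʳ a) ⟩
  0ℚ                                             ∎
  where
  open ≡-Reasoning
  g-vanishes : coeff g (suc k) ≡ 0ℚ
  g-vanishes = g<e (suc k) (s≤s (ℕ.≤-trans (ℕ.m≤n+m e m) m+e≤k))
  fg-vanishes : coeff (f *ₚ g) k ≡ 0ℚ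
  fg-vanishes = *ₚ-degreeBelow m e f g (λ i m≤i → f<m (suc i) (s≤s m≤i)) g<e k m+e≤k

*ₚ-coeff-leading : ∀ d e f g → DegreeBelow (suc d) f → DegreeBelow (suc e) g →
                   coeff (f *ₚ g) (d + e) ≡ coeff f d *q coeff g e
*ₚ-coeff-leading d       e []      g _   _   = sym (ℚ.*-zeroˡ (coeff g e))
*ₚ-coeff-leading zero    e (a ∷ f) g f<1 g<e = begin
  coeff ((a ∷ f) *ₚ g) e                    ≡⟨ coeff-∷*ₚ a f g e ⟩
  a *q coeff g e +q coeff (0ℚ ∷ f *ₚ g) e   ≡⟨ cong (a *q coeff g e +q_) (coeff-≡ 0∷fg≋[] e) ⟩
  a *q coeff g e +q 0ℚ                      ≡⟨ ℚ.+-identityʳ _ ⟩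
  a *q coeff g e                            ∎
  where
  open ≡-Reasoning
  f≋[] : f ≋ []
  f≋[] = degreeBelow-zero f (λ k _ → f<1 (suc k) (s≤s z≤n))
  0∷fg≋[] : 0ℚ ∷ f *ₚ g ≋ []
  0∷fg≋[] = ≋-trans (∷-cong refl (*ₚ-cong f≋[] (≋-refl {g}))) 0∷[]≋[]
*ₚ-coeff-leading (suc d) e (a ∷ f) g f<d g<e = begin
  coeff ((a ∷ f) *ₚ g) (suc (d + e))                   ≡⟨ coeff-∷*ₚ a f g (suc (d + e)) ⟩
  a *q coeff g (suc (d + e)) +q coeff (f *ₚ g) (d + e) ≡⟨ cong₂ (λ x y → a *q x +q y) g-vanishes leading ⟩
  a *q 0ℚ +q coeff f d *q coeff g e                    ≡⟨ cong (_+q _) (ℚ.*-zeroʳ a) ⟩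
  0ℚ +q coeff f d *q coeff g e                         ≡⟨ ℚ.+-identityˡ _ ⟩
  coeff f d *q coeff g e                               ∎
  where
  open ≡-Reasoning
  g-vanishes : coeff g (suc (d + e)) ≡ 0ℚ
  g-vanishes = g<e (suc (d + e)) (s≤s (ℕ.m≤n+m e d))
  leading : coeff (f *ₚ g) (d + e) ≡ coeff f d *q coeff g e
  leading = *ₚ-coeff-leading d e f g (λ i d<i → f<d (suc i) (s≤s d<i)) g<e

*ₚ-hasDegree : ∀ {d e f g} → HasDegree d f → HasDegree e g → HasDegree (d + e) (f *ₚ g)
*ₚ-hasDegree {d} {e} {f} {g} deg-f deg-g = record
  { degreeBelow = *ₚ-degreeBelow (suc d) e f g (degreeBelow deg-f) (degreeBelow deg-g)
  ; leading≢0   = λ fg≡0 → x#0y#0→xy#0 (leading≢0 deg-f) (leading≢0 deg-g)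
                    (trans (sym (*ₚ-coeff-leading d e f g (degreeBelow deg-f) (degreeBelow deg-g))) fg≡0)
  }

^ₚ-hasDegree : ∀ {f} → HasDegree 1 f → ∀ n → HasDegree n (f ^ₚ n)
^ₚ-hasDegree deg-f zero    = record { degreeBelow = λ { (suc k) _ → refl } ; leading≢0 = ℚ.1≢0 }
^ₚ-hasDegree deg-f (suc n) = *ₚ-hasDegree deg-f (^ₚ-hasDegree deg-f n)

zₚ-hasDegree : HasDegree 1 zₚ
zₚ-hasDegree = record { degreeBelow = degreeBelow-linear 0ℚ 1ℚ ; leading≢0 = ℚ.1≢0 }

oneMinusZ-hasDegree : HasDegree 1 oneMinusZ
oneMinusZ-hasDegree = record { degreeBelow = degreeBelow-linear 1ℚ (- 1ℚ) ; leading≢0 = λ () }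

Dr-hasDegree : ∀ r m {f} → HasDegree (r + m) f → HasDegree m (Dr r f)
Dr-hasDegree r m {f} deg-f = record
  { degreeBelow = λ k m<k → begin
      coeff (Dr r f) k                ≡⟨ coeff-Dr r f k ⟩
      Dr-scale r k *q coeff f (r + k) ≡⟨ cong (Dr-scale r k *q_) (degreeBelow deg-f (r + k) (ℕ.+-monoʳ-< r m<k)) ⟩
      Dr-scale r k *q 0ℚ              ≡⟨ ℚ.*-zeroʳ (Dr-scale r k) ⟩
      0ℚ                              ∎
  ; leading≢0 = λ Drf≡0 → x#0y#0→xy#0 (Dr-scale≢0 r m) (leading≢0 deg-f) (trans (sym (coeff-Dr r f m)) Drf≡0)
  }
  where open ≡-Reasoning

-- Linear maps that hit every degree are onto

cancel-leading : ∀ {m} f {g} → DegreeBelow (suc m) f → HasDegree m g →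
                 ∃ λ a → DegreeBelow m (f +ₚ (- a) ·ₚ g)
cancel-leading {m} f {g} f<m deg-g = a , vanishes
  where
  open ≡-Reasoning
  c : ℚ
  c = coeff g m
  instance
    c≢0 : NonZero c
    c≢0 = ≢-nonZero (leading≢0 deg-g)
  a : ℚ
  a = coeff f m ÷ c

  coeff-difference : ∀ k → coeff (f +ₚ (- a) ·ₚ g) k ≡ coeff f k +q (- a) *q coeff g k
  coeff-difference k = trans (coeff-+ₚ f ((- a) ·ₚ g) k) (cong (coeff f k +q_) (coeff-·ₚ (- a) g k))

  a*c≡f : a *q c ≡ coeff f m
  a*c≡f = begin
    coeff f m *q 1/ c *q c    ≡⟨ ℚ.*-assoc (coeff f m) (1/ c) c ⟩
    coeff f m *q (1/ c *q c)  ≡⟨ cong (coeff f m *q_) (ℚ.*-inverseˡ c) ⟩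
    coeff f m *q 1ℚ           ≡⟨ ℚ.*-identityʳ (coeff f m) ⟩
    coeff f m                 ∎

  vanishes : DegreeBelow m (f +ₚ (- a) ·ₚ g)
  vanishes k m≤k with ℕ.m≤n⇒m<n∨m≡n m≤k
  ... | inj₁ m<k = begin
    coeff (f +ₚ (- a) ·ₚ g) k          ≡⟨ coeff-difference k ⟩
    coeff f k +q (- a) *q coeff g k    ≡⟨ cong₂ (λ x y → x +q (- a) *q y) (f<m k m<k) (degreeBelow deg-g k m<k) ⟩
    0ℚ +q (- a) *q 0ℚ                  ≡⟨ trans (ℚ.+-identityˡ _) (ℚ.*-zeroʳ (- a)) ⟩
    0ℚ                                 ∎
  ... | inj₂ refl = begin
    coeff (f +ₚ (- a) ·ₚ g) m          ≡⟨ coeff-difference m ⟩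
    coeff f m +q (- a) *q c            ≡⟨ cong (coeff f m +q_) (ℚ.neg-distribˡ-* a c) ⟨
    coeff f m +q - (a *q c)            ≡⟨ cong (λ x → coeff f m +q - x) a*c≡f ⟩
    coeff f m +q - coeff f m           ≡⟨ ℚ.+-inverseʳ (coeff f m) ⟩
    0ℚ                                 ∎

record IsLinear (T : Poly → Poly) : Set where
  field
    resp-≋  : ∀ {f g} → f ≋ g → T f ≋ T g
    +ₚ-homo : ∀ f g → T (f +ₚ g) ≋ T f +ₚ T g
    ·ₚ-homo : ∀ c f → T (c ·ₚ f) ≋ c ·ₚ T f

  []-homo : T [] ≋ []
  []-homo = ≋-trans (·ₚ-homo 0ℚ []) (·ₚ-zeroˡ (T []))

∘-isLinear : ∀ {T U} → IsLinear T → IsLinear U → IsLinear (T ∘ U)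
∘-isLinear {T} {U} T-linear U-linear = record
  { resp-≋  = T.resp-≋ ∘ U.resp-≋
  ; +ₚ-homo = λ f g → ≋-trans (T.resp-≋ (U.+ₚ-homo f g)) (T.+ₚ-homo (U f) (U g))
  ; ·ₚ-homo = λ c f → ≋-trans (T.resp-≋ (U.·ₚ-homo c f)) (T.·ₚ-homo c (U f))
  }
  where
  module T = IsLinear T-linear
  module U = IsLinear U-linear

*ₚ-isLinear : ∀ w → IsLinear (w *ₚ_)
*ₚ-isLinear w = record
  { resp-≋  = *ₚ-congˡ w
  ; +ₚ-homo = *ₚ-distribˡ-+ₚ w
  ; ·ₚ-homo = λ c f → *ₚ-·ₚʳ c w f
  }

Dr-isLinear : ∀ r → IsLinear (Dr r)
Dr-isLinear r = record
  { resp-≋  = λ {f} {g} f≋g → coeffwise λ k → begin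
      coeff (Dr r f) k                 ≡⟨ coeff-Dr r f k ⟩
      Dr-scale r k *q coeff f (r + k)  ≡⟨ cong (Dr-scale r k *q_) (coeff-≡ f≋g (r + k)) ⟩
      Dr-scale r k *q coeff g (r + k)  ≡⟨ coeff-Dr r g k ⟨
      coeff (Dr r g) k                 ∎
  ; +ₚ-homo = λ f g → coeffwise λ k → begin
      coeff (Dr r (f +ₚ g)) k
        ≡⟨ coeff-Dr r (f +ₚ g) k ⟩
      Dr-scale r k *q coeff (f +ₚ g) (r + k)
        ≡⟨ cong (Dr-scale r k *q_) (coeff-+ₚ f g (r + k)) ⟩
      Dr-scale r k *q (coeff f (r + k) +q coeff g (r + k))
        ≡⟨ ℚ.*-distribˡ-+ (Dr-scale r k) (coeff f (r + k)) (coeff g (r + k)) ⟩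
      Dr-scale r k *q coeff f (r + k) +q Dr-scale r k *q coeff g (r + k)
        ≡⟨ cong₂ _+q_ (coeff-Dr r f k) (coeff-Dr r g k) ⟨
      coeff (Dr r f) k +q coeff (Dr r g) k
        ≡⟨ coeff-+ₚ (Dr r f) (Dr r g) k ⟨
      coeff (Dr r f +ₚ Dr r g) k
        ∎
  ; ·ₚ-homo = λ c f → coeffwise λ k → begin
      coeff (Dr r (c ·ₚ f)) k                 ≡⟨ coeff-Dr r (c ·ₚ f) k ⟩
      Dr-scale r k *q coeff (c ·ₚ f) (r + k)  ≡⟨ cong (Dr-scale r k *q_) (coeff-·ₚ c f (r + k)) ⟩
      Dr-scale r k *q (c *q coeff f (r + k))  ≡⟨ solve 3 (λ s c x → s :* (c :* x) := c :* (s :* x)) refl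
                                                   (Dr-scale r k) c (coeff f (r + k)) ⟩
      c *q (Dr-scale r k *q coeff f (r + k))  ≡⟨ cong (c *q_) (coeff-Dr r f k) ⟨
      c *q coeff (Dr r f) k                   ≡⟨ coeff-·ₚ c (Dr r f) k ⟨
      coeff (c ·ₚ Dr r f) k                   ∎
  }
  where open ≡-Reasoning

HitsEveryDegree : (Poly → Poly) → Set
HitsEveryDegree T = ∀ m → ∃ λ g → HasDegree m (T g)

hitsEveryDegree⇒surjective : ∀ {T} → IsLinear T → HitsEveryDegree T → ∀ f → ∃ λ g → T g ≋ f
hitsEveryDegree⇒surjective {T} T-linear T-hits f = reach (length f) f (degreeBelow-length f)
  where
  open IsLinear T-linear
  open ≋-Reasoning
  reach : ∀ m f → DegreeBelow m f → ∃ λ g → T g ≋ f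
  reach zero    f f<0 = [] , ≋-trans []-homo (≋-sym (degreeBelow-zero f f<0))
  reach (suc m) f f<m with T-hits m
  ... | g , deg-Tg with cancel-leading f f<m deg-Tg
  ... | a , f′<m with reach m (f +ₚ (- a) ·ₚ T g) f′<m
  ... | g′ , Tg′≋f′ = g′ +ₚ a ·ₚ g , (begin
    T (g′ +ₚ a ·ₚ g)                  ≈⟨ +ₚ-homo g′ (a ·ₚ g) ⟩
    T g′ +ₚ T (a ·ₚ g)                ≈⟨ +ₚ-cong Tg′≋f′ (·ₚ-homo a g) ⟩
    (f +ₚ (- a) ·ₚ T g) +ₚ a ·ₚ T g   ≈⟨ +ₚ-neg-·ₚ-cancel f a (T g) ⟩
    f                                 ∎)

-- The operators 𝒟

weight : ℕ → ℕ → Poly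
weight a b = zₚ ^ₚ a *ₚ oneMinusZ ^ₚ b

weight-hasDegree : ∀ a b → HasDegree (a + b) (weight a b)
weight-hasDegree a b = *ₚ-hasDegree (^ₚ-hasDegree zₚ-hasDegree a) (^ₚ-hasDegree oneMinusZ-hasDegree b)

weight-+ : ∀ a b c d → weight (a + c) (b + d) ≋ weight a b *ₚ weight c d
weight-+ a b c d = begin
  zₚ ^ₚ (a + c) *ₚ oneMinusZ ^ₚ (b + d)
    ≈⟨ *ₚ-cong (^ₚ-homo-*ₚ zₚ a c) (^ₚ-homo-*ₚ oneMinusZ b d) ⟩
  (zₚ ^ₚ a *ₚ zₚ ^ₚ c) *ₚ (oneMinusZ ^ₚ b *ₚ oneMinusZ ^ₚ d)
    ≈⟨ *ₚ.interchange (zₚ ^ₚ a) (zₚ ^ₚ c) (oneMinusZ ^ₚ b) (oneMinusZ ^ₚ d) ⟩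
  weight a b *ₚ weight c d
    ∎
  where open ≋-Reasoning

weight-split : ∀ {a a′ b b′} → a′ ≤ a → b′ ≤ b → weight a b ≋ weight a′ b′ *ₚ weight (a ∸ a′) (b ∸ b′)
weight-split {a} {a′} {b} {b′} a′≤a b′≤b = ≋-trans
  (≋-reflexive (sym (cong₂ weight (ℕ.m+[n∸m]≡n a′≤a) (ℕ.m+[n∸m]≡n b′≤b))))
  (weight-+ a′ b′ (a ∸ a′) (b ∸ b′))

𝒟-inner : ℕ → ℕ → Poly → Poly
𝒟-inner p q P = Dr (p + q) (weight p q *ₚ P)

𝒟-inner-surjective : ∀ p q f → ∃ λ g → 𝒟-inner p q g ≋ f
𝒟-inner-surjective p q = hitsEveryDegree⇒surjective
  (∘-isLinear (Dr-isLinear (p + q)) (*ₚ-isLinear (weight p q)))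
  (λ m → zₚ ^ₚ m , Dr-hasDegree (p + q) m (*ₚ-hasDegree (weight-hasDegree p q) (^ₚ-hasDegree zₚ-hasDegree m)))

lemma4p2 : (p p′ q q′ : ℕ) → p′ ≤ p → q′ ≤ q →
    (P : Poly) → ∃ λ (R : Poly) → 𝒟 p q P ≈ₚ 𝒟 p′ q′ R
lemma4p2 p p′ q q′ p′≤p q′≤q P with 𝒟-inner-surjective p′ q′ (weight (q ∸ q′) (p ∸ p′) *ₚ 𝒟-inner p q P)
... | R , inner-R≋ = R , coeff-≡ (begin
  weight q p *ₚ 𝒟-inner p q P
    ≈⟨ *ₚ-cong (weight-split q′≤q p′≤p) (≋-refl {𝒟-inner p q P}) ⟩
  weight q′ p′ *ₚ weight (q ∸ q′) (p ∸ p′) *ₚ 𝒟-inner p q P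
    ≈⟨ *ₚ-assoc (weight q′ p′) (weight (q ∸ q′) (p ∸ p′)) (𝒟-inner p q P) ⟩
  weight q′ p′ *ₚ (weight (q ∸ q′) (p ∸ p′) *ₚ 𝒟-inner p q P)
    ≈⟨ *ₚ-congˡ (weight q′ p′) inner-R≋ ⟨
  weight q′ p′ *ₚ 𝒟-inner p′ q′ R
    ∎)
  where open ≋-Reasoning
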